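{- Let $[60]=\{1,2,\dots,60\}$. For $i=1,\dots,10$ let $G_i=\{6(i-1)+1,\,6(i-1)+2,\,\dots,\,6i\}$, and write $G_i^{(1)}=\{6(i-1)+1,6(i-1)+2,6(i-1)+3\}$ and $G_i^{(2)}=\{6(i-1)+4,6(i-1)+5,6i\}$. Let $\mathcal{B}$ be the family of $30$ six-element subsets of $[60]$ consisting of the ten sets $G_1,\dots,G_{10}$ together with the twenty sets $G_{2m-1}^{(u)}\cup G_{2m}^{(v)}$ for $m\in\{1,2,3,4,5\}$ and $u,v\in\{1,2\}$. Then for every $S\subset[60]$ with $|S|=6$ there exists $B\in\mathcal{B}$ such that $|S\cap B|\ge 2$. Equivalently, every $6$-subset $S$ of $[60]$ contains a pair $\{x,y\}\subset S$ that is contained in at least one block $B\in\mathcal{B}$. -}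

module Defs where

open import Data.Nat using (ℕ; _+_; _*_; _≤ᵇ_; _<ᵇ_)
open import Data.Bool using (Bool; _∧_)
open import Data.Fin using (Fin; toℕ)
open import Data.Fin.Subset using (Subset; _∪_)
open import Data.Vec using (tabulate)
open import Data.List using (List; _∷_; []; _++_; concatMap; map)

-- Convention: the ground set [60] = {1,...,60} is represented by Fin 60,
-- the element x ∈ Fin 60 standing for the integer toℕ x + 1.
-- Groups are indexed 0-based: group index i : ℕ (0 ≤ i < 10) stands for G_{i+1}.

interval : ℕ → ℕ → Subset 60
interval lo hi = tabulate (λ x → (lo ≤ᵇ toℕ x) ∧ (toℕ x <ᵇ hi))

G : ℕ → Subset 60
G i = interval (6 * i) (6 * i + 6)

G¹ : ℕ → Subset 60
G¹ i = interval (6 * i) (6 * i + 3)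

G² : ℕ → Subset 60
G² i = interval (6 * i + 3) (6 * i + 6)

halves : ℕ → List (Subset 60)
halves i = G¹ i ∷ G² i ∷ []

groups : List (Subset 60)
groups = map G (0 ∷ 1 ∷ 2 ∷ 3 ∷ 4 ∷ 5 ∷ 6 ∷ 7 ∷ 8 ∷ 9 ∷ [])

-- for m = k+1 ∈ {1..5}: the four sets G_{2m-1}^{(u)} ∪ G_{2m}^{(v)}, u,v ∈ {1,2}
-- (G_{2m-1} has 0-based index 2k, G_{2m} has 0-based index 2k+1)
crossBlocks : ℕ → List (Subset 60)
crossBlocks k = concatMap (λ A → map (λ B → A ∪ B) (halves (2 * k + 1))) (halves (2 * k))

𝓑 : List (Subset 60)
𝓑 = groups ++ concatMap crossBlocks (0 ∷ 1 ∷ 2 ∷ 3 ∷ 4 ∷ [])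

-- Cut [60] into five chunks G_{2m-1} ∪ G_{2m} of twelve points and each chunk into its four
-- triples G_i^{(u)}. The six blocks of 𝓑 inside a chunk are exactly the unions of two of its
-- four triples, so any two points of a chunk lie in a common block. Since six points cannot
-- meet five chunks at most once each, some chunk contains two points of S.
module Submission where

open import Defs
open import Data.Nat using (ℕ; zero; suc; _+_; _*_; _≤_; _<_; z≤n; s≤s; ≤-pred; _<?_)
open import Data.Nat.Properties
  using (+-identityʳ; +-comm; +-cancelˡ-<; +-monoˡ-≤; <-≤-trans; ≮⇒≥; *-zeroʳ; n<1+n)
open import Data.Bool.Properties using () renaming (_≟_ to _≟ᵇ_)
open import Data.Fin using (Fin; zero; suc)
open import Data.Fin.Properties using (all?; suc-injective) renaming (_≟_ to _≟ᶠ_)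
open import Data.Fin.Subset using (Subset; inside; outside; ∣_∣; _∩_; _∪_; ⊥; ⊤)
open import Data.Fin.Subset.Properties using (∣⊥∣≡0; ∩-zeroʳ; ∩-identityʳ; ∪-identityˡ; ∪-identityʳ; ∪-comm)
open import Data.Vec using (Vec; []; _∷_; _++_; concat; group; lookup; map; sum)
open import Data.Vec.Properties using (zipWith-++; ≡-dec)
open import Data.List.Membership.Propositional using (_∈_)
open import Data.List.Membership.DecPropositional (≡-dec {n = 60} _≟ᵇ_) using (_∈?_)
open import Function using (_∘_)
open import Data.Product using (Σ-syntax; ∃-syntax; ∃₂; _×_; _,_)
open import Relation.Nullary using (yes; no; ¬?)
open import Relation.Nullary.Decidable using (from-yes; _→-dec_)
open import Relation.Binary.PropositionalEquality using (_≡_; _≢_; refl; sym; trans; cong; cong₂; subst)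
open Relation.Binary.PropositionalEquality.≡-Reasoning

private
  variable
    m n : ℕ
    A : Set

pigeonhole-sum : (f : A → ℕ) (k : ℕ) (xs : Vec A n) → n * k < sum (map f xs) → ∃[ i ] k < f (lookup xs i)
pigeonhole-sum f k (x ∷ xs) nk<Σ with k <? f x
... | yes k<fx = zero , k<fx
... | no  k≮fx =
  let i , k<fxᵢ = pigeonhole-sum f k xs
                    (+-cancelˡ-< k _ _ (<-≤-trans nk<Σ (+-monoˡ-≤ (sum (map f xs)) (≮⇒≥ k≮fx))))
  in suc i , k<fxᵢ

pigeonhole-sum-pos : (f : A → ℕ) (xs : Vec A n) → 0 < sum (map f xs) → ∃[ i ] 0 < f (lookup xs i)
pigeonhole-sum-pos {n = n} f xs 0<Σ = pigeonhole-sum f 0 xs (subst (_< sum (map f xs)) (sym (*-zeroʳ n)) 0<Σ)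

2≤sum⇒2≤pair-sum : (f : A → ℕ) (xs : Vec A (2 + n)) → 2 ≤ sum (map f xs) →
                   ∃₂ λ i j → i ≢ j × 2 ≤ f (lookup xs i) + f (lookup xs j)
2≤sum⇒2≤pair-sum {n = zero} f (x ∷ y ∷ []) 2≤Σ =
  zero , suc zero , (λ ()) , subst (2 ≤_) (cong (f x +_) (+-identityʳ (f y))) 2≤Σ
2≤sum⇒2≤pair-sum {n = suc n} f (x ∷ xs) 2≤Σ with f x in fx≡
... | 0 =
  let i , j , i≢j , 2≤fᵢ+fⱼ = 2≤sum⇒2≤pair-sum f xs 2≤Σ
  in suc i , suc j , i≢j ∘ suc-injective , 2≤fᵢ+fⱼ
... | 1 =
  let j , 0<fⱼ = pigeonhole-sum-pos f xs (≤-pred 2≤Σ)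
  in zero , suc j , (λ ()) , subst (λ a → 2 ≤ a + f (lookup xs j)) (sym fx≡) (s≤s 0<fⱼ)
... | suc (suc a) =
  zero , suc zero , (λ ()) , subst (λ b → 2 ≤ b + f (lookup xs zero)) (sym fx≡) (s≤s (s≤s z≤n))

∣p++q∣≡∣p∣+∣q∣ : (p : Subset m) (q : Subset n) → ∣ p ++ q ∣ ≡ ∣ p ∣ + ∣ q ∣
∣p++q∣≡∣p∣+∣q∣ []            q = refl
∣p++q∣≡∣p∣+∣q∣ (outside ∷ p) q = ∣p++q∣≡∣p∣+∣q∣ p q
∣p++q∣≡∣p∣+∣q∣ (inside ∷ p)  q = cong suc (∣p++q∣≡∣p∣+∣q∣ p q)

∣concat∣≡sum : (ps : Vec (Subset m) n) → ∣ concat ps ∣ ≡ sum (map ∣_∣ ps)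
∣concat∣≡sum []       = refl
∣concat∣≡sum (p ∷ ps) = trans (∣p++q∣≡∣p∣+∣q∣ p (concat ps)) (cong (∣ p ∣ +_) (∣concat∣≡sum ps))

∣++∩++∣ : (p r : Subset m) (q s : Subset n) → ∣ (p ++ q) ∩ (r ++ s) ∣ ≡ ∣ p ∩ r ∣ + ∣ q ∩ s ∣
∣++∩++∣ p r q s = trans (cong ∣_∣ (zipWith-++ _ p q r s)) (∣p++q∣≡∣p∣+∣q∣ (p ∩ r) (q ∩ s))

∪-++ : (p r : Subset m) (q s : Subset n) → (p ++ q) ∪ (r ++ s) ≡ (p ∪ r) ++ (q ∪ s)
∪-++ p r q s = zipWith-++ _ p q r s

∣p∩⊥∣≡0 : (p : Subset n) → ∣ p ∩ ⊥ ∣ ≡ 0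
∣p∩⊥∣≡0 {n} p = trans (cong ∣_∣ (∩-zeroʳ p)) (∣⊥∣≡0 n)

-- A subset of Fin (n * m) is read as n consecutive cells of size m; place i p puts p in cell i.
place : Fin n → Subset m → Subset (n * m)
place zero    p = p ++ ⊥
place (suc i) p = ⊥ ++ place i p

∣concat∩place∣ : (ps : Vec (Subset m) n) (i : Fin n) (q : Subset m) →
                 ∣ concat ps ∩ place i q ∣ ≡ ∣ lookup ps i ∩ q ∣
∣concat∩place∣ (p ∷ ps) zero q = begin
  ∣ (p ++ concat ps) ∩ (q ++ ⊥) ∣  ≡⟨ ∣++∩++∣ p q (concat ps) ⊥ ⟩
  ∣ p ∩ q ∣ + ∣ concat ps ∩ ⊥ ∣    ≡⟨ cong (∣ p ∩ q ∣ +_) (∣p∩⊥∣≡0 (concat ps)) ⟩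
  ∣ p ∩ q ∣ + 0                     ≡⟨ +-identityʳ _ ⟩
  ∣ p ∩ q ∣                         ∎
∣concat∩place∣ (p ∷ ps) (suc i) q = begin
  ∣ (p ++ concat ps) ∩ (⊥ ++ place i q) ∣  ≡⟨ ∣++∩++∣ p ⊥ (concat ps) (place i q) ⟩
  ∣ p ∩ ⊥ ∣ + ∣ concat ps ∩ place i q ∣    ≡⟨ cong (_+ ∣ concat ps ∩ place i q ∣) (∣p∩⊥∣≡0 p) ⟩
  ∣ concat ps ∩ place i q ∣                 ≡⟨ ∣concat∩place∣ ps i q ⟩
  ∣ lookup ps i ∩ q ∣                       ∎

∣concat∩place⊤∣ : (ps : Vec (Subset m) n) (i : Fin n) → ∣ concat ps ∩ place i ⊤ ∣ ≡ ∣ lookup ps i ∣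
∣concat∩place⊤∣ ps i = trans (∣concat∩place∣ ps i ⊤) (cong ∣_∣ (∩-identityʳ (lookup ps i)))

module _ {m : ℕ} where
  -- Cell sizes cannot be inferred through n * m, so ⊤ and ⊥ are pinned to size m.
  private
    ⊤ₘ ⊥ₘ : Subset m
    ⊤ₘ = ⊤
    ⊥ₘ = ⊥

  ∣concat∩place₀∪place∣ : (p : Subset m) (ps : Vec (Subset m) n) (j : Fin n) →
                          ∣ concat (p ∷ ps) ∩ (place (zero {n}) ⊤ₘ ∪ place (suc j) ⊤ₘ) ∣ ≡ ∣ p ∣ + ∣ lookup ps j ∣
  ∣concat∩place₀∪place∣ {n = n} p ps j = begin
    ∣ (p ++ concat ps) ∩ ((⊤ₘ ++ ⊥) ∪ (⊥ₘ ++ place j ⊤ₘ)) ∣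
      ≡⟨ cong (λ b → ∣ (p ++ concat ps) ∩ b ∣) cells-∪ ⟩
    ∣ (p ++ concat ps) ∩ (⊤ₘ ++ place j ⊤ₘ) ∣
      ≡⟨ ∣++∩++∣ p ⊤ (concat ps) (place j ⊤ₘ) ⟩
    ∣ p ∩ ⊤ ∣ + ∣ concat ps ∩ place j ⊤ ∣
      ≡⟨ cong₂ _+_ (cong ∣_∣ (∩-identityʳ p)) (∣concat∩place⊤∣ ps j) ⟩
    ∣ p ∣ + ∣ lookup ps j ∣
      ∎
    where
    cells-∪ : (⊤ₘ ++ ⊥) ∪ (⊥ₘ ++ place j ⊤ₘ) ≡ ⊤ₘ ++ place j ⊤ₘ
    cells-∪ = trans (∪-++ ⊤ₘ ⊥ ⊥ (place j ⊤ₘ)) (cong₂ _++_ (∪-identityʳ ⊤ₘ) (∪-identityˡ (place j ⊤ₘ)))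

  ∣concat∩place∪place∣ : (ps : Vec (Subset m) n) (i j : Fin n) → i ≢ j →
                         ∣ concat ps ∩ (place i ⊤ₘ ∪ place j ⊤ₘ) ∣ ≡ ∣ lookup ps i ∣ + ∣ lookup ps j ∣
  ∣concat∩place∪place∣ ps zero zero i≢j with () ← i≢j refl
  ∣concat∩place∪place∣ (p ∷ ps) zero (suc j) _ = ∣concat∩place₀∪place∣ p ps j
  ∣concat∩place∪place∣ {n = suc n} (p ∷ ps) (suc i) zero _ = begin
    ∣ concat (p ∷ ps) ∩ (place (suc i) ⊤ₘ ∪ place (zero {n}) ⊤ₘ) ∣
      ≡⟨ cong (λ b → ∣ concat (p ∷ ps) ∩ b ∣) (∪-comm (place (suc i) ⊤ₘ) (place (zero {n}) ⊤ₘ)) ⟩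
    ∣ concat (p ∷ ps) ∩ (place (zero {n}) ⊤ₘ ∪ place (suc i) ⊤ₘ) ∣
      ≡⟨ ∣concat∩place₀∪place∣ p ps i ⟩
    ∣ p ∣ + ∣ lookup ps i ∣
      ≡⟨ +-comm ∣ p ∣ ∣ lookup ps i ∣ ⟩
    ∣ lookup ps i ∣ + ∣ p ∣
      ∎
  ∣concat∩place∪place∣ (p ∷ ps) (suc i) (suc j) si≢sj = begin
    ∣ (p ++ concat ps) ∩ ((⊥ₘ ++ place i ⊤ₘ) ∪ (⊥ₘ ++ place j ⊤ₘ)) ∣
      ≡⟨ cong (λ b → ∣ (p ++ concat ps) ∩ b ∣) cells-∪ ⟩
    ∣ (p ++ concat ps) ∩ (⊥ₘ ++ (place i ⊤ₘ ∪ place j ⊤ₘ)) ∣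
      ≡⟨ ∣++∩++∣ p ⊥ (concat ps) (place i ⊤ₘ ∪ place j ⊤ₘ) ⟩
    ∣ p ∩ ⊥ ∣ + ∣ concat ps ∩ (place i ⊤ₘ ∪ place j ⊤ₘ) ∣
      ≡⟨ cong₂ _+_ (∣p∩⊥∣≡0 p) (∣concat∩place∪place∣ ps i j (si≢sj ∘ cong suc)) ⟩
    ∣ lookup ps i ∣ + ∣ lookup ps j ∣
      ∎
    where
    cells-∪ : (⊥ₘ ++ place i ⊤ₘ) ∪ (⊥ₘ ++ place j ⊤ₘ) ≡ ⊥ₘ ++ (place i ⊤ₘ ∪ place j ⊤ₘ)
    cells-∪ = trans (∪-++ ⊥ₘ ⊥ₘ (place i ⊤ₘ) (place j ⊤ₘ)) (cong (_++ (place i ⊤ₘ ∪ place j ⊤ₘ)) (∪-identityˡ ⊥ₘ))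

  ∃-cell-pair-meeting-twice : (p : Subset ((2 + n) * m)) → 2 ≤ ∣ p ∣ →
                              ∃₂ λ i j → i ≢ j × 2 ≤ ∣ p ∩ (place i ⊤ₘ ∪ place j ⊤ₘ) ∣
  ∃-cell-pair-meeting-twice {n} p 2≤∣p∣ with ps , refl ← group (2 + n) m p =
    let i , j , i≢j , 2≤∣pᵢ∣+∣pⱼ∣ = 2≤sum⇒2≤pair-sum ∣_∣ ps (subst (2 ≤_) (∣concat∣≡sum ps) 2≤∣p∣)
    in i , j , i≢j , subst (2 ≤_) (sym (∣concat∩place∪place∣ ps i j i≢j)) 2≤∣pᵢ∣+∣pⱼ∣

-- block k i j is the union of the i-th and j-th triples G_l^{(u)} inside the k-th chunk
-- G_{2k+1} ∪ G_{2k+2}; for i ≢ j these are exactly the thirty blocks of 𝓑.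
block : Fin 5 → Fin 4 → Fin 4 → Subset 60
block k i j = place {m = 12} k (place {m = 3} i ⊤ ∪ place {m = 3} j ⊤)

block∈𝓑 : ∀ k i j → i ≢ j → block k i j ∈ 𝓑
block∈𝓑 = from-yes (all? λ k → all? λ i → all? λ j → ¬? (i ≟ᶠ j) →-dec (block k i j ∈? 𝓑))

theorem1 : (S : Subset 60) → ∣ S ∣ ≡ 6 → Σ[ B ∈ Subset 60 ] (B ∈ 𝓑 × 2 ≤ ∣ S ∩ B ∣)
theorem1 S ∣S∣≡6
  with cs , refl ← group 5 12 S
  with k , 2≤∣c∣ ← pigeonhole-sum ∣_∣ 1 cs (subst (5 <_) (trans (sym ∣S∣≡6) (∣concat∣≡sum cs)) (n<1+n 5))
  with i , j , i≢j , 2≤∣c∩B∣ ← ∃-cell-pair-meeting-twice {3} (lookup cs k) 2≤∣c∣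
  = block k i j , block∈𝓑 k i j i≢j , subst (2 ≤_) (sym (∣concat∩place∣ cs k _)) 2≤∣c∩B∣
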